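{- Let $i, j, k, \ell \in \mathbb{N}^+$ with $i < j < k$ and $3 \le \ell \le j-i+2$. Then the number of ways to split $2k+j$ balls into exactly $\ell$ nonempty ordered bins so that one bin has exactly $k$ balls and another has exactly $k+i$ balls is $$U_{2k+j,\ell,[k+i,k]} = (\ell^2-\ell)\binom{j-i-1}{\ell-3}.$$
   Context: $U_{2k+j,\ell,[k+i,k]}$ denotes the number of $(x_1,\dots,x_\ell)\in(\mathbb{Z}_{>0})^\ell$ with $\sum x_m = 2k+j$ such that some $x_a = k$ and some other $x_b = k+i$. -}

module Defs where

open import Data.Nat using (ℕ; zero; suc; _+_; _∸_)
open import Data.Nat.Properties using (_≟_)
open import Data.Fin using (Fin)
import Data.Fin.Properties as FinP
open import Data.Vec using (Vec; []; _∷_; lookup)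
open import Data.List using (List; []; _∷_; map; concatMap; applyUpTo; filter; length)
open import Data.Product using (Σ; ∃; _×_; _,_)
open import Relation.Binary.PropositionalEquality using (_≡_; _≢_)
open import Relation.Nullary using (Dec; ¬?)
open import Relation.Nullary.Decidable using (_×-dec_)

compositions : ℕ → (ℓ : ℕ) → List (Vec ℕ ℓ)
compositions zero    zero    = [] ∷ []
compositions (suc _) zero    = []
compositions n       (suc ℓ) =
  concatMap (λ x → map (x ∷_) (compositions (n ∸ x) ℓ)) (applyUpTo suc n)

HasPair : ∀ {ℓ} → ℕ → ℕ → Vec ℕ ℓ → Set
HasPair {ℓ} a b v =
  ∃ λ (p : Fin ℓ) → ∃ λ (q : Fin ℓ) → (p ≢ q) × (lookup v p ≡ a) × (lookup v q ≡ b)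

hasPair? : ∀ {ℓ} (a b : ℕ) (v : Vec ℕ ℓ) → Dec (HasPair a b v)
hasPair? a b v = FinP.any? λ p → FinP.any? λ q →
  ¬? (p FinP.≟ q) ×-dec (lookup v p ≟ a) ×-dec (lookup v q ≟ b)

U : ℕ → ℕ → ℕ → ℕ → ℕ
U n ℓ b a = length (filter (hasPair? a b) (compositions n ℓ))

-- Split off the first part x of a composition of a + b + m into ℓ parts, where m < a, b and a ≢ b.
-- If x ≤ m, the remaining parts form a composition of the same shape with a smaller m. Otherwise
-- x must be a or b, since any other part exceeding m leaves too little for both a and b; the rest
-- is then a composition of b + m (resp. a + m) containing b (resp. a). The same recursion shows
-- that ℓ · N(m, ℓ − 1) compositions of a + m into ℓ parts contain a, where N(m, p) = C(m − 1, p − 1)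
-- counts compositions of m into p parts, and so ℓ (ℓ − 1) · N(m, ℓ − 2) compositions of a + b + m
-- contain both a and b. The theorem is the case a = k, b = k + i, m = j − i.

module Submission where

open import Defs
open import Data.Nat using (ℕ; _+_; _*_; _∸_; _≤_; _<_)
open import Data.Nat.Combinatorics using (_C_)
open import Relation.Binary.PropositionalEquality using (_≡_)

open import Data.Nat using (zero; suc; z≤n; s≤s; z<s; s<s; NonZero; >-nonZero; _≟_)
open import Data.Nat.Properties
open import Data.Nat.Combinatorics using (nCk+nC[k+1]≡[n+1]C[k+1])
open import Data.Nat.Solver using (module +-*-Solver)
open import Data.List using (List; []; _∷_; _++_; map; concatMap; applyUpTo; filter; length)
open import Data.List.Properties using (length-++; filter-++; filter-≐; filter-all)
open import Data.List.Relation.Unary.All using (universal-U)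
open import Data.Vec using (Vec; _∷_; lookup)
open import Data.Vec.Relation.Unary.Any using (here; there; index; tail)
open import Data.Vec.Relation.Unary.Any.Properties using (lookup-index)
open import Data.Vec.Membership.Propositional using (_∈_)
open import Data.Vec.Membership.Propositional.Properties using (∈-lookup)
open import Data.Vec.Membership.DecPropositional _≟_ using (_∈?_)
open import Data.Empty using (⊥-elim)
open import Data.Unit using (⊤; tt)
open import Data.Product using (_×_; _,_; proj₁)
open import Function using (_∘_)
open import Relation.Binary.PropositionalEquality
  using (_≢_; refl; sym; trans; cong; cong₂; subst; module ≡-Reasoning)
open import Relation.Nullary using (yes; no)
open import Relation.Nullary.Decidable using (_×-dec_)
open import Relation.Unary using (Pred; Decidable; _≐_)
open import Relation.Unary.Properties using (U?)

∑< : ℕ → (ℕ → ℕ) → ℕ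
∑< zero    f = 0
∑< (suc n) f = f 0 + ∑< n (f ∘ suc)

∑<-cong : ∀ n {f g : ℕ → ℕ} → (∀ x → x < n → f x ≡ g x) → ∑< n f ≡ ∑< n g
∑<-cong zero    f≡g = refl
∑<-cong (suc n) f≡g = cong₂ _+_ (f≡g 0 z<s) (∑<-cong n λ x x<n → f≡g (suc x) (s<s x<n))

∑<-zero : ∀ n {f : ℕ → ℕ} → (∀ x → x < n → f x ≡ 0) → ∑< n f ≡ 0
∑<-zero zero    f≡0 = refl
∑<-zero (suc n) f≡0 rewrite f≡0 0 z<s = ∑<-zero n λ x x<n → f≡0 (suc x) (s<s x<n)

∑<-distribˡ : ∀ c n (f : ℕ → ℕ) → ∑< n (λ x → c * f x) ≡ c * ∑< n f
∑<-distribˡ c zero    f = sym (*-zeroʳ c)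
∑<-distribˡ c (suc n) f = begin
  c * f 0 + ∑< n (λ x → c * f (suc x)) ≡⟨ cong (c * f 0 +_) (∑<-distribˡ c n (f ∘ suc)) ⟩
  c * f 0 + c * ∑< n (f ∘ suc)         ≡⟨ *-distribˡ-+ c (f 0) _ ⟨
  c * ∑< (suc n) f                     ∎
  where open ≡-Reasoning

∑<-+ : ∀ m r (f : ℕ → ℕ) → ∑< (m + r) f ≡ ∑< m f + ∑< r (λ x → f (m + x))
∑<-+ zero    r f = refl
∑<-+ (suc m) r f = trans (cong (f 0 +_) (∑<-+ m r (f ∘ suc))) (sym (+-assoc (f 0) _ _))

∑<-select : ∀ n {c} {f : ℕ → ℕ} → c < n → (∀ x → x < n → x ≢ c → f x ≡ 0) →
            ∑< n f ≡ f c
∑<-select (suc n) {zero} _ f≡0 =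
  trans (cong (_ +_) (∑<-zero n λ x x<n → f≡0 (suc x) (s<s x<n) λ ())) (+-identityʳ _)
∑<-select (suc n) {suc c} (s≤s c<n) f≡0 rewrite f≡0 0 z<s (λ ()) =
  ∑<-select n c<n λ x x<n x≢c → f≡0 (suc x) (s<s x<n) (x≢c ∘ suc-injective)

∑<-select₂ : ∀ n {c d} {f : ℕ → ℕ} → c < n → d < n → c ≢ d →
             (∀ x → x < n → x ≢ c → x ≢ d → f x ≡ 0) → ∑< n f ≡ f c + f d
∑<-select₂ (suc n) {zero}  {zero}  _ _ c≢d _ = ⊥-elim (c≢d refl)
∑<-select₂ (suc n) {zero}  {suc d} _ (s≤s d<n) _ f≡0 =
  cong (_ +_) (∑<-select n d<n λ x x<n x≢d → f≡0 (suc x) (s<s x<n) (λ ()) (x≢d ∘ suc-injective))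
∑<-select₂ (suc n) {suc c} {zero} {f} (s≤s c<n) _ _ f≡0 =
  trans (cong (_ +_) (∑<-select n c<n λ x x<n x≢c →
                        f≡0 (suc x) (s<s x<n) (x≢c ∘ suc-injective) (λ ())))
        (+-comm (f 0) _)
∑<-select₂ (suc n) {suc c} {suc d} (s≤s c<n) (s≤s d<n) c≢d f≡0 rewrite f≡0 0 z<s (λ ()) (λ ()) =
  ∑<-select₂ n c<n d<n (c≢d ∘ cong suc)
    λ x x<n x≢c x≢d → f≡0 (suc x) (s<s x<n) (x≢c ∘ suc-injective) (x≢d ∘ suc-injective)

count : ∀ {a p} {A : Set a} {P : Pred A p} → Decidable P → List A → ℕ
count P? xs = length (filter P? xs)

count-++ : ∀ {a p} {A : Set a} {P : Pred A p} (P? : Decidable P) (xs ys : List A) →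
           count P? (xs ++ ys) ≡ count P? xs + count P? ys
count-++ P? xs ys = trans (cong length (filter-++ P? xs ys)) (length-++ (filter P? xs))

count-≐ : ∀ {a p q} {A : Set a} {P : Pred A p} {Q : Pred A q} {P? : Decidable P} {Q? : Decidable Q} →
          P ≐ Q → ∀ xs → count P? xs ≡ count Q? xs
count-≐ {P? = P?} {Q?} P≐Q xs = cong length (filter-≐ P? Q? P≐Q xs)

count-map : ∀ {a b p} {A : Set a} {B : Set b} {P : Pred B p} (P? : Decidable P) (f : A → B) xs →
            count P? (map f xs) ≡ count (P? ∘ f) xs
count-map P? f []       = refl
count-map P? f (x ∷ xs) with P? (f x)
... | yes _ = cong suc (count-map P? f xs)
... | no  _ = count-map P? f xs

count-U : ∀ {a} {A : Set a} (xs : List A) → count U? xs ≡ length xs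
count-U xs = cong length (filter-all U? (universal-U xs))

count-concatMap : ∀ {b p} {B : Set b} {P : Pred B p} (P? : Decidable P)
                  (F : ℕ → List B) (g : ℕ → ℕ) n →
                  count P? (concatMap F (applyUpTo g n)) ≡ ∑< n (λ x → count P? (F (g x)))
count-concatMap P? F g zero    = refl
count-concatMap P? F g (suc n) =
  trans (count-++ P? (F (g 0)) (concatMap F (applyUpTo (g ∘ suc) n)))
        (cong (count P? (F (g 0)) +_) (count-concatMap P? F (g ∘ suc) n))

compositions-suc : ∀ n ℓ → compositions n (suc ℓ) ≡
                   concatMap (λ x → map (x ∷_) (compositions (n ∸ x) ℓ)) (applyUpTo suc n)
compositions-suc zero    ℓ = refl
compositions-suc (suc n) ℓ = refl

count-compositions-suc : ∀ {p ℓ} {P : Pred (Vec ℕ (suc ℓ)) p} (P? : Decidable P) n →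
  count P? (compositions n (suc ℓ)) ≡
  ∑< n (λ x → count (P? ∘ (suc x ∷_)) (compositions (n ∸ suc x) ℓ))
count-compositions-suc {ℓ = ℓ} P? n rewrite compositions-suc n ℓ =
  trans (count-concatMap P? (λ x → map (x ∷_) (compositions (n ∸ x) ℓ)) suc n)
        (∑<-cong n λ x _ → count-map P? (suc x ∷_) (compositions (n ∸ suc x) ℓ))

length-compositions-suc : ∀ n ℓ → length (compositions n (suc ℓ)) ≡
                          ∑< n (λ x → length (compositions (n ∸ suc x) ℓ))
length-compositions-suc n ℓ = begin
  length (compositions n (suc ℓ))
    ≡⟨ count-U (compositions n (suc ℓ)) ⟨
  count U? (compositions n (suc ℓ))
    ≡⟨ count-compositions-suc U? n ⟩
  ∑< n (λ x → count U? (compositions (n ∸ suc x) ℓ))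
    ≡⟨ ∑<-cong n (λ x _ → count-U (compositions (n ∸ suc x) ℓ)) ⟩
  ∑< n (λ x → length (compositions (n ∸ suc x) ℓ)) ∎
  where open ≡-Reasoning

length-compositions-pascal : ∀ n q → length (compositions (suc n) (suc q)) ≡
                             length (compositions n q) + length (compositions n (suc q))
length-compositions-pascal n q =
  trans (length-compositions-suc (suc n) q)
        (cong (length (compositions n q) +_) (sym (length-compositions-suc n q)))

length-compositions : ∀ m p → length (compositions (suc m) (suc p)) ≡ m C p
length-compositions zero    zero    = refl
length-compositions zero    (suc p) = refl
length-compositions (suc m) zero    =
  trans (length-compositions-pascal (suc m) zero) (length-compositions m zero)
length-compositions (suc m) (suc p) = begin
  length (compositions (2 + m) (2 + p))
    ≡⟨ length-compositions-pascal (suc m) (suc p) ⟩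
  length (compositions (suc m) (suc p)) + length (compositions (suc m) (2 + p))
    ≡⟨ cong₂ _+_ (length-compositions m p) (length-compositions m (suc p)) ⟩
  m C p + m C suc p
    ≡⟨ nCk+nC[k+1]≡[n+1]C[k+1] m p ⟩
  suc m C suc p ∎
  where open ≡-Reasoning

∑<-length-compositions : ∀ ℓ m →
  ∑< m (λ x → ℓ * length (compositions (m ∸ suc x) (ℓ ∸ 1))) ≡ ℓ * length (compositions m ℓ)
∑<-length-compositions zero    m = ∑<-distribˡ 0 m (λ x → length (compositions (m ∸ suc x) 0))
∑<-length-compositions (suc ℓ) m =
  trans (∑<-distribˡ (suc ℓ) m _) (cong (suc ℓ *_) (sym (length-compositions-suc m ℓ)))

m+n∸[1+n+o]<m : ∀ m n o → .{{NonZero m}} → m + n ∸ suc (n + o) < m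
m+n∸[1+n+o]<m m n o = m<n+o⇒m∸n<o (m + n) (suc (n + o)) (s≤s (begin
  m + n      ≡⟨ +-comm m n ⟩
  n + m      ≤⟨ +-monoˡ-≤ m (m≤m+n n o) ⟩
  n + o + m  ∎))
  where open ≤-Reasoning

module _ {ℓ : ℕ} where

  ∈-∷-≡ : ∀ {a x} → x ≡ a → (λ (v : Vec ℕ ℓ) → a ∈ x ∷ v) ≐ (λ _ → ⊤)
  ∈-∷-≡ x≡a = (λ _ → tt) , (λ _ → here (sym x≡a))

  ∈-∷-≢ : ∀ {a x} → x ≢ a → (λ (v : Vec ℕ ℓ) → a ∈ x ∷ v) ≐ (a ∈_)
  ∈-∷-≢ x≢a = tail (x≢a ∘ sym) , there

  both∈? : (a b : ℕ) → Decidable (λ (v : Vec ℕ ℓ) → a ∈ v × b ∈ v)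
  both∈? a b v = a ∈? v ×-dec b ∈? v

  both∈-∷-≢ : ∀ {a b x} → x ≢ a → x ≢ b →
              (λ (v : Vec ℕ ℓ) → a ∈ x ∷ v × b ∈ x ∷ v) ≐ (λ v → a ∈ v × b ∈ v)
  both∈-∷-≢ x≢a x≢b =
    (λ (a∈ , b∈) → proj₁ (∈-∷-≢ x≢a) a∈ , proj₁ (∈-∷-≢ x≢b) b∈) ,
    (λ (a∈ , b∈) → there a∈ , there b∈)

  both∈-∷-≡ˡ : ∀ {a b x} → x ≡ a → a ≢ b → (λ (v : Vec ℕ ℓ) → a ∈ x ∷ v × b ∈ x ∷ v) ≐ (b ∈_)
  both∈-∷-≡ˡ x≡a a≢b =
    (λ (_ , b∈) → proj₁ (∈-∷-≢ (λ x≡b → a≢b (trans (sym x≡a) x≡b))) b∈) ,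
    (λ b∈ → here (sym x≡a) , there b∈)

  both∈-∷-≡ʳ : ∀ {a b x} → x ≡ b → a ≢ b → (λ (v : Vec ℕ ℓ) → a ∈ x ∷ v × b ∈ x ∷ v) ≐ (a ∈_)
  both∈-∷-≡ʳ x≡b a≢b =
    (λ (a∈ , _) → proj₁ (∈-∷-≢ (λ x≡a → a≢b (trans (sym x≡a) x≡b))) a∈) ,
    (λ a∈ → there a∈ , here (sym x≡b))

  hasPair≐both∈ : ∀ {a b} → a ≢ b → HasPair {ℓ} a b ≐ (λ v → a ∈ v × b ∈ v)
  hasPair≐both∈ a≢b =
    (λ {v} (p , q , _ , vp≡a , vq≡b) →
      subst (_∈ v) vp≡a (∈-lookup p v) , subst (_∈ v) vq≡b (∈-lookup q v)) ,
    (λ {v} (a∈ , b∈) →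
      index a∈ , index b∈ ,
      (λ p≡q → a≢b (trans (lookup-index a∈) (trans (cong (lookup v) p≡q) (sym (lookup-index b∈))))) ,
      sym (lookup-index a∈) , sym (lookup-index b∈))

count-∈-compositions-< : ∀ ℓ {a n} → n < a → count (a ∈?_) (compositions n ℓ) ≡ 0
count-∈-compositions-< zero    {n = zero}  _ = refl
count-∈-compositions-< zero    {n = suc _} _ = refl
count-∈-compositions-< (suc ℓ) {a} {n} n<a =
  trans (count-compositions-suc (a ∈?_) n) (∑<-zero n λ x x<n →
    trans (count-≐ (∈-∷-≢ (<⇒≢ (≤-<-trans x<n n<a))) (compositions (n ∸ suc x) ℓ))
          (count-∈-compositions-< ℓ (≤-<-trans (m∸n≤m n (suc x)) n<a)))

count-∈-compositions : ∀ ℓ {a m} → m < a →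
  count (a ∈?_) (compositions (a + m) ℓ) ≡ ℓ * length (compositions m (ℓ ∸ 1))
count-∈-compositions zero    {suc _} _ = refl
count-∈-compositions (suc ℓ) {a} {m} m<a = begin
  count (a ∈?_) (compositions (a + m) (suc ℓ))  ≡⟨ count-compositions-suc (a ∈?_) (a + m) ⟩
  ∑< (a + m) h                                 ≡⟨ cong (λ n → ∑< n h) (+-comm a m) ⟩
  ∑< (m + a) h                                 ≡⟨ ∑<-+ m a h ⟩
  ∑< m h + ∑< a (λ x → h (m + x))
                                               ≡⟨ cong₂ _+_ (∑<-cong m first<a) (∑<-select a c<a first≢a) ⟩
  ∑< m (λ x → ℓ * length (compositions (m ∸ suc x) (ℓ ∸ 1))) + h (m + c)
                                               ≡⟨ cong₂ _+_ (∑<-length-compositions ℓ m) first≡a ⟩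
  ℓ * length (compositions m ℓ) + length (compositions m ℓ)
                                               ≡⟨ +-comm (ℓ * _) _ ⟩
  suc ℓ * length (compositions m ℓ)            ∎
  where
  open ≡-Reasoning
  instance _ = >-nonZero (≤-<-trans z≤n m<a)

  rest : ℕ → List (Vec ℕ ℓ)
  rest x = compositions (a + m ∸ suc x) ℓ

  h : ℕ → ℕ
  h x = count ((a ∈?_) ∘ (suc x ∷_)) (rest x)

  c : ℕ
  c = a ∸ suc m

  1+m+c≡a : suc (m + c) ≡ a
  1+m+c≡a = m+[n∸m]≡n m<a

  c<a : c < a
  c<a = subst (c <_) 1+m+c≡a (s≤s (m≤n+m c m))

  first<a : ∀ x → x < m → h x ≡ ℓ * length (compositions (m ∸ suc x) (ℓ ∸ 1))
  first<a x x<m = begin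
    h x  ≡⟨ count-≐ (∈-∷-≢ (<⇒≢ (≤-<-trans x<m m<a))) (rest x) ⟩
    count (a ∈?_) (compositions (a + m ∸ suc x) ℓ)
         ≡⟨ cong (λ n → count (a ∈?_) (compositions n ℓ)) (+-∸-assoc a x<m) ⟩
    count (a ∈?_) (compositions (a + (m ∸ suc x)) ℓ)
         ≡⟨ count-∈-compositions ℓ (≤-<-trans (m∸n≤m m (suc x)) m<a) ⟩
    ℓ * length (compositions (m ∸ suc x) (ℓ ∸ 1)) ∎

  first≡a : h (m + c) ≡ length (compositions m ℓ)
  first≡a = begin
    h (m + c)  ≡⟨ count-≐ (∈-∷-≡ 1+m+c≡a) (rest (m + c)) ⟩
    count U? (rest (m + c))  ≡⟨ count-U (rest (m + c)) ⟩
    length (compositions (a + m ∸ suc (m + c)) ℓ)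
               ≡⟨ cong (λ n → length (compositions (a + m ∸ n) ℓ)) 1+m+c≡a ⟩
    length (compositions (a + m ∸ a) ℓ)  ≡⟨ cong (λ n → length (compositions n ℓ)) (m+n∸m≡n a m) ⟩
    length (compositions m ℓ) ∎

  first≢a : ∀ x → x < a → x ≢ c → h (m + x) ≡ 0
  first≢a x _ x≢c =
    trans (count-≐ (∈-∷-≢ λ e → x≢c (+-cancelˡ-≡ (suc m) x c (trans e (sym 1+m+c≡a))))
                   (rest (m + x)))
          (count-∈-compositions-< ℓ (m+n∸[1+n+o]<m a m x))

count-∈-compositions-∸ : ∀ ℓ {a m n y} → m < a → n ≡ y + (a + m) →
  count (a ∈?_) (compositions (n ∸ y) ℓ) ≡ ℓ * length (compositions m (ℓ ∸ 1))
count-∈-compositions-∸ ℓ {a} {m} {y = y} m<a refl =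
  trans (cong (λ n → count (a ∈?_) (compositions n ℓ)) (m+n∸m≡n y (a + m))) (count-∈-compositions ℓ m<a)

count-both∈-compositions-< : ∀ ℓ {a b n} → .{{NonZero a}} → .{{NonZero b}} → a ≢ b → n < a + b →
  count (both∈? a b) (compositions n ℓ) ≡ 0
count-both∈-compositions-< zero    {n = zero}  _ _ = refl
count-both∈-compositions-< zero    {n = suc _} _ _ = refl
count-both∈-compositions-< (suc ℓ) {a} {b} {n} a≢b n<a+b =
  trans (count-compositions-suc (both∈? a b) n) (∑<-zero n first)
  where
  rest : ℕ → List (Vec ℕ ℓ)
  rest x = compositions (n ∸ suc x) ℓ

  first : ∀ x → x < n → count (both∈? a b ∘ (suc x ∷_)) (rest x) ≡ 0
  first x _ with suc x ≟ a | suc x ≟ b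
  ... | yes 1+x≡a | _ =
    trans (count-≐ (both∈-∷-≡ˡ 1+x≡a a≢b) (rest x))
          (count-∈-compositions-< ℓ (subst (λ y → n ∸ y < b) (sym 1+x≡a) (m<n+o⇒m∸n<o n a n<a+b)))
  ... | no _ | yes 1+x≡b =
    trans (count-≐ (both∈-∷-≡ʳ 1+x≡b a≢b) (rest x))
          (count-∈-compositions-< ℓ (subst (λ y → n ∸ y < a) (sym 1+x≡b)
            (m<n+o⇒m∸n<o n b (subst (n <_) (+-comm a b) n<a+b))))
  ... | no 1+x≢a | no 1+x≢b =
    trans (count-≐ (both∈-∷-≢ 1+x≢a 1+x≢b) (rest x))
          (count-both∈-compositions-< ℓ a≢b (≤-<-trans (m∸n≤m n (suc x)) n<a+b))

∑<-length-compositions₂ : ∀ ℓ m →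
  ∑< m (λ x → ℓ * ((ℓ ∸ 1) * length (compositions (m ∸ suc x) (ℓ ∸ 2)))) ≡
  ℓ * ((ℓ ∸ 1) * length (compositions m (ℓ ∸ 1)))
∑<-length-compositions₂ zero    m = ∑<-distribˡ 0 m (λ x → length (compositions (m ∸ suc x) 0))
∑<-length-compositions₂ (suc ℓ) m =
  trans (∑<-distribˡ (suc ℓ) m _) (cong (suc ℓ *_) (∑<-length-compositions ℓ m))

m*[[m∸1]*n]+[m*n+m*n]≡[1+m]*[m*n] : ∀ m n → m * ((m ∸ 1) * n) + (m * n + m * n) ≡ suc m * (m * n)
m*[[m∸1]*n]+[m*n+m*n]≡[1+m]*[m*n] zero    n = refl
m*[[m∸1]*n]+[m*n+m*n]≡[1+m]*[m*n] (suc m) n = solve 2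
  (λ m n → (con 1 :+ m) :* (m :* n) :+ ((con 1 :+ m) :* n :+ (con 1 :+ m) :* n)
        := (con 2 :+ m) :* ((con 1 :+ m) :* n)) refl m n
  where open +-*-Solver

count-both∈-compositions : ∀ ℓ {a b m} → m < a → m < b → a ≢ b →
  count (both∈? a b) (compositions (a + b + m) ℓ) ≡ ℓ * ((ℓ ∸ 1) * length (compositions m (ℓ ∸ 2)))
count-both∈-compositions zero    {suc _} _ _ _ = refl
count-both∈-compositions (suc ℓ) {a} {b} {m} m<a m<b a≢b = begin
  count (both∈? a b) (compositions (a + b + m) (suc ℓ))
    ≡⟨ count-compositions-suc (both∈? a b) (a + b + m) ⟩
  ∑< (a + b + m) h
    ≡⟨ cong (λ n → ∑< n h) (+-comm (a + b) m) ⟩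
  ∑< (m + (a + b)) h
    ≡⟨ ∑<-+ m (a + b) h ⟩
  ∑< m h + ∑< (a + b) (λ x → h (m + x))
    ≡⟨ cong₂ _+_ (∑<-cong m first<m) (∑<-select₂ (a + b) c<a+b d<a+b c≢d first∉) ⟩
  ∑< m (λ x → ℓ * ((ℓ ∸ 1) * length (compositions (m ∸ suc x) (ℓ ∸ 2)))) + (h (m + c) + h (m + d))
    ≡⟨ cong₂ _+_ (∑<-length-compositions₂ ℓ m) (cong₂ _+_ first≡a first≡b) ⟩
  ℓ * ((ℓ ∸ 1) * length (compositions m (ℓ ∸ 1))) +
    (ℓ * length (compositions m (ℓ ∸ 1)) + ℓ * length (compositions m (ℓ ∸ 1)))
    ≡⟨ m*[[m∸1]*n]+[m*n+m*n]≡[1+m]*[m*n] ℓ (length (compositions m (ℓ ∸ 1))) ⟩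
  suc ℓ * (ℓ * length (compositions m (ℓ ∸ 1))) ∎
  where
  open ≡-Reasoning
  instance
    _ = >-nonZero (≤-<-trans z≤n m<a)
    _ = >-nonZero (≤-<-trans z≤n m<b)

  rest : ℕ → List (Vec ℕ ℓ)
  rest x = compositions (a + b + m ∸ suc x) ℓ

  h : ℕ → ℕ
  h x = count (both∈? a b ∘ (suc x ∷_)) (rest x)

  c d : ℕ
  c = a ∸ suc m
  d = b ∸ suc m

  1+m+c≡a : suc (m + c) ≡ a
  1+m+c≡a = m+[n∸m]≡n m<a

  1+m+d≡b : suc (m + d) ≡ b
  1+m+d≡b = m+[n∸m]≡n m<b

  c<a+b : c < a + b
  c<a+b = <-≤-trans (subst (c <_) 1+m+c≡a (s≤s (m≤n+m c m))) (m≤m+n a b)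

  d<a+b : d < a + b
  d<a+b = <-≤-trans (subst (d <_) 1+m+d≡b (s≤s (m≤n+m d m))) (m≤n+m b a)

  c≢d : c ≢ d
  c≢d c≡d = a≢b (trans (sym 1+m+c≡a) (trans (cong (suc ∘ (m +_)) c≡d) 1+m+d≡b))

  first<m : ∀ x → x < m → h x ≡ ℓ * ((ℓ ∸ 1) * length (compositions (m ∸ suc x) (ℓ ∸ 2)))
  first<m x x<m = begin
    h x  ≡⟨ count-≐ (both∈-∷-≢ (<⇒≢ (≤-<-trans x<m m<a)) (<⇒≢ (≤-<-trans x<m m<b))) (rest x) ⟩
    count (both∈? a b) (rest x)
         ≡⟨ cong (λ n → count (both∈? a b) (compositions n ℓ)) (+-∸-assoc (a + b) x<m) ⟩
    count (both∈? a b) (compositions (a + b + (m ∸ suc x)) ℓ)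
         ≡⟨ count-both∈-compositions ℓ (≤-<-trans (m∸n≤m m (suc x)) m<a)
                                       (≤-<-trans (m∸n≤m m (suc x)) m<b) a≢b ⟩
    ℓ * ((ℓ ∸ 1) * length (compositions (m ∸ suc x) (ℓ ∸ 2))) ∎

  first≡a : h (m + c) ≡ ℓ * length (compositions m (ℓ ∸ 1))
  first≡a = trans (count-≐ (both∈-∷-≡ˡ 1+m+c≡a a≢b) (rest (m + c)))
                  (count-∈-compositions-∸ ℓ m<b (begin
                    a + b + m             ≡⟨ +-assoc a b m ⟩
                    a + (b + m)           ≡⟨ cong (_+ (b + m)) 1+m+c≡a ⟨
                    suc (m + c) + (b + m) ∎))

  first≡b : h (m + d) ≡ ℓ * length (compositions m (ℓ ∸ 1))
  first≡b = trans (count-≐ (both∈-∷-≡ʳ 1+m+d≡b a≢b) (rest (m + d)))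
                  (count-∈-compositions-∸ ℓ m<a (begin
                    a + b + m             ≡⟨ cong (_+ m) (+-comm a b) ⟩
                    b + a + m             ≡⟨ +-assoc b a m ⟩
                    b + (a + m)           ≡⟨ cong (_+ (a + m)) 1+m+d≡b ⟨
                    suc (m + d) + (a + m) ∎))

  first∉ : ∀ x → x < a + b → x ≢ c → x ≢ d → h (m + x) ≡ 0
  first∉ x _ x≢c x≢d =
    trans (count-≐ (both∈-∷-≢ (λ e → x≢c (+-cancelˡ-≡ (suc m) x c (trans e (sym 1+m+c≡a))))
                              (λ e → x≢d (+-cancelˡ-≡ (suc m) x d (trans e (sym 1+m+d≡b)))))
                   (rest (m + x)))
          (count-both∈-compositions-< ℓ a≢b 
            (m+n∸[1+n+o]<m (a + b) m x {{>-nonZero (<-≤-trans (≤-<-trans z≤n m<a) (m≤m+n a b))}}))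

mainTheorem10 : (i j k ℓ : ℕ) → 1 ≤ i → i < j → j < k →
    3 ≤ ℓ → ℓ ≤ j ∸ i + 2 →
    U (2 * k + j) ℓ (k + i) k ≡ (ℓ * ℓ ∸ ℓ) * ((j ∸ i ∸ 1) C (ℓ ∸ 3))
mainTheorem10 i j k ℓ@(suc (suc (suc p))) 1≤i i<j j<k (s≤s (s≤s (s≤s _))) _ = begin
  U (2 * k + j) ℓ (k + i) k
    ≡⟨ count-≐ {P? = hasPair? k (k + i)} (hasPair≐both∈ k≢k+i) (compositions (2 * k + j) ℓ) ⟩
  count (both∈? k (k + i)) (compositions (2 * k + j) ℓ)
    ≡⟨ cong (λ n → count (both∈? k (k + i)) (compositions n ℓ)) 2k+j≡k+[k+i]+r ⟩
  count (both∈? k (k + i)) (compositions (k + (k + i) + r) ℓ)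
    ≡⟨ count-both∈-compositions ℓ r<k (<-≤-trans r<k (m≤m+n k i)) k≢k+i ⟩
  ℓ * ((ℓ ∸ 1) * length (compositions r (ℓ ∸ 2)))
    ≡⟨ *-assoc ℓ (ℓ ∸ 1) (length (compositions r (ℓ ∸ 2))) ⟨
  ℓ * (ℓ ∸ 1) * length (compositions r (ℓ ∸ 2))
    ≡⟨ cong (λ n → ℓ * (ℓ ∸ 1) * length (compositions n (ℓ ∸ 2))) 1+[r∸1]≡r ⟨
  ℓ * (ℓ ∸ 1) * length (compositions (suc (r ∸ 1)) (suc p))
    ≡⟨ cong₂ _*_ (trans (*-distribˡ-∸ ℓ ℓ 1) (cong (ℓ * ℓ ∸_) (*-identityʳ ℓ)))
                 (length-compositions (r ∸ 1) p) ⟩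
  (ℓ * ℓ ∸ ℓ) * ((r ∸ 1) C p) ∎
  where
  open ≡-Reasoning
  r : ℕ
  r = j ∸ i

  r<k : r < k
  r<k = ≤-<-trans (m∸n≤m j i) j<k

  1+[r∸1]≡r : suc (r ∸ 1) ≡ r
  1+[r∸1]≡r = m+[n∸m]≡n (m<n⇒0<n∸m i<j)

  k≢k+i : k ≢ k + i
  k≢k+i k≡k+i = <⇒≢ (+-monoʳ-< k 1≤i) (trans (+-identityʳ k) k≡k+i)

  2k+j≡k+[k+i]+r : 2 * k + j ≡ k + (k + i) + r
  2k+j≡k+[k+i]+r = trans (cong (2 * k +_) (sym (m+[n∸m]≡n (<⇒≤ i<j))))
                         (solve 3 (λ k i r → con 2 :* k :+ (i :+ r) := k :+ (k :+ i) :+ r) refl k i r)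
    where open +-*-Solver
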